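{- Every formula of $\overline{SC_1}=\{\overline F:F\in SC_1\}$ is provably equivalent in intuitionistic second-order logic ($\vdash^2_i$) to at least one formula of $SC_2$, and every formula of $SC_2$ is so equivalent to at least one formula of $\overline{SC_1}$.
   Context: The second-order language $\mathcal L_2$ has: - logical symbols $\bot,\to,\wedge,\vee,\forall,\exists$; - a countable set $\mathcal V$ of first-order variables; - a countable set $\Sigma$ of function symbols, from which terms are built; - for each $n\in\mathbb N$, a countable set $\mathcal V_n$ of second-order variables of arity $n$. Its atomic formulas are $\bot$ and $X^n(t_1,\dots,t_n)$, with quantification over first- and second-order variables. The first-order language $\mathcal L_1$ has the same $\mathcal V$ and $\Sigma$ and, for each $n$, a relation symbol $\mathrm{Ap}_n$ of arity $n+1$ (and no others). $\mathrm{Free}(F)$ denotes the set of free variables, and $F\leftrightarrow G$ abbreviates $(F\to G)\wedge(G\to F)$. Fix for each $n$ a bijection $\phi_n:\mathcal V_n\to\mathcal V$. The coding $F\mapsto F^*$ ($\mathcal L_2\to\mathcal L_1$) is defined by: - $\bot^*=\bot$; - $(X^n(t_1,\dots,t_n))^*=\mathrm{Ap}_n(\phi_n(X^n),t_1,\dots,t_n)$; - $(A\diamond B)^*=A^*\diamond B^*$ for $\diamond\in\{\to,\wedge,\vee\}$; - $(Qx\,A)^*=Qy\,(A[x:=y])^*$ with $y\notin\mathrm{Free}(A^*)$; - $(QX^n\,A)^*=Qy\,(A[X^n:=Y^n])^*$ with $\phi_n(Y^n)=y$ and $y\notin\mathrm{Free}(A^*)$. The reverse coding $F\mapsto\overline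 F$ ($\mathcal L_1\to\mathcal L_2$) is defined by: - $\overline\bot=\bot$; - $\overline{\mathrm{Ap}_n(x,t_1,\dots,t_n)}=\phi_n^{ -1}(x)(t_1,\dots,t_n)$ when $x$ is a variable; - $\overline{\mathrm{Ap}_n(t,t_1,\dots,t_n)}=\bot$ when $t$ is not a variable; - $\overline{A\diamond B}=\overline A\diamond\overline B$; - $\overline{Qx\,A}=Qx\,QX^{i_1}\dots QX^{i_p}\,\overline A$, where $i_1<\dots<i_p$ and $\{X^{i_1},\dots,X^{i_p}\}$ is the set of those variables $\phi_n^{ -1}(x)$ ($n\in\mathbb N$) free in $\overline A$. $SC_2$ is the set of all closed $\mathcal L_2$-formulas $\forall\chi_1\dots\forall\chi_m\,\exists X^n\,\forall x_1\dots\forall x_n\,(G\leftrightarrow X^n(x_1,\dots,x_n))$, where $x_j\in\mathcal V$, the $\chi_j$ are first- or second-order variables, $\mathrm{Free}(G)\subseteq\{x_1,\dots,x_n,\chi_1,\dots,\chi_m\}$, and $X^n\notin\mathrm{Free}(G)$. Finally, $SC_1=\{F^*:F\in SC_2\}$. -}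

module Defs where

open import Data.Nat using (ℕ; zero; suc; _⊔_; _≟_)
open import Data.Bool using (Bool; true; false; not; if_then_else_) renaming (_∧_ to _&&_; _∨_ to _||_)
open import Data.List using (List; []; _∷_; _++_; map; foldr; upTo; concatMap; filterᵇ)
open import Data.Bool.ListAction using (any)
open import Data.Vec using (Vec; []; _∷_; tabulate)
import Data.Vec as Vec
open import Data.Fin using (toℕ)
open import Data.Maybe using (Maybe; just; nothing; _>>=_)
import Data.Maybe as Maybe
open import Data.Product using (Σ; _×_; _,_)
open import Relation.Nullary using (yes; no)
open import Relation.Nullary.Decidable using (⌊_⌋)
open import Relation.Binary.PropositionalEquality using (_≡_; refl)
open import Data.List.Membership.Propositional using (_∈_)
open import Function.Bundles using (_↔_; Inverse)

-- Terms over countably many first-order variables (ℕ) and countably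
-- many function symbols; a function symbol is a pair (arity k, name f).
data Term : Set where
  var : ℕ → Term
  fun : (k f : ℕ) → Vec Term k → Term

data Conn : Set where
  imp and or : Conn

data Quant : Set where
  all ex : Quant

eqℕ : ℕ → ℕ → Bool
eqℕ x y = ⌊ x ≟ y ⌋

memℕ : ℕ → List ℕ → Bool
memℕ x = any (eqℕ x)

maxℕ : List ℕ → ℕ
maxℕ = foldr _⊔_ 0

mutual
  tvars : Term → List ℕ
  tvars (var x) = x ∷ []
  tvars (fun k f ts) = tvarsV ts

  tvarsV : ∀ {k} → Vec Term k → List ℕ
  tvarsV [] = []
  tvarsV (t ∷ ts) = tvars t ++ tvarsV ts

mutual
  tsub : (ℕ → Term) → Term → Term
  tsub σ (var x) = σ x
  tsub σ (fun k f ts) = fun k f (tsubV σ ts)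

  tsubV : ∀ {k} → (ℕ → Term) → Vec Term k → Vec Term k
  tsubV σ [] = []
  tsubV σ (t ∷ ts) = tsub σ t ∷ tsubV σ ts

-- The second-order language L₂ (named variables).
-- Second-order variables of arity n are named by ℕ:  X^n  is  (n , X).

data Form₂ : Set where
  ⊥₂  : Form₂
  pv  : (n X : ℕ) → Vec Term n → Form₂
  bin : Conn → Form₂ → Form₂ → Form₂
  qf  : Quant → ℕ → Form₂ → Form₂
  qs  : Quant → (n X : ℕ) → Form₂ → Form₂

infix 5 _⇔_
_⇔_ : Form₂ → Form₂ → Form₂
A ⇔ B = bin and (bin imp A B) (bin imp B A)

data Var : Set where
  fo : ℕ → Var
  so : ℕ → ℕ → Var

eqV : Var → Var → Bool
eqV (fo x) (fo y) = eqℕ x y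
eqV (so n X) (so m Y) = eqℕ n m && eqℕ X Y
eqV _ _ = false

memV : Var → List Var → Bool
memV v = any (eqV v)

remove : Var → List Var → List Var
remove v = filterᵇ (λ w → not (eqV w v))

FV : Form₂ → List Var
FV ⊥₂ = []
FV (pv n X ts) = so n X ∷ map fo (tvarsV ts)
FV (bin c A B) = FV A ++ FV B
FV (qf q x A) = remove (fo x) (FV A)
FV (qs q n X A) = remove (so n X) (FV A)

FVctx : List Form₂ → List Var
FVctx = concatMap FV

Closed : Form₂ → Set
Closed F = FV F ≡ []

-- Substitutions (partial: they return nothing when a variable capture
-- would occur; no renaming of bound variables is performed).

upd : (ℕ → Term) → ℕ → Term → (ℕ → Term)
upd σ x t y = if eqℕ y x then t else σ y

fvFO : Form₂ → List ℕ
fvFO A = concatMap (λ { (fo x) → x ∷ [] ; (so _ _) → [] }) (FV A)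

sub₁ : (ℕ → Term) → Form₂ → Maybe Form₂
sub₁ σ ⊥₂ = just ⊥₂
sub₁ σ (pv n X ts) = just (pv n X (tsubV σ ts))
sub₁ σ (bin c A B) = sub₁ σ A >>= λ A' → sub₁ σ B >>= λ B' → just (bin c A' B')
sub₁ σ (qf q y A) =
  if any (λ z → not (eqℕ z y) && memℕ y (tvars (σ z))) (fvFO A)
  then nothing
  else Maybe.map (qf q y) (sub₁ (upd σ y (var y)) A)
sub₁ σ (qs q n X A) = Maybe.map (qs q n X) (sub₁ σ A)

subst₁ : ℕ → Term → Form₂ → Maybe Form₂
subst₁ x t = sub₁ (upd var x t)

-- σ sending xᵢ to tᵢ (first occurrence wins), identity elsewhere
zipσ : ∀ {k} → Vec ℕ k → Vec Term k → ℕ → Term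
zipσ [] [] = var
zipσ (x ∷ xs) (t ∷ ts) = upd (zipσ xs ts) x t

FVabs : ∀ {k} → Vec ℕ k → Form₂ → List Var
FVabs xs G = filterᵇ (λ v → not (any (λ x → eqV v (fo x)) (Vec.toList xs))) (FV G)

-- A[X^n := λ x₁…xₙ. G]   (each X^n(t⃗) replaced by G[x⃗ := t⃗])
sub₂ : (n X : ℕ) → Vec ℕ n → Form₂ → Form₂ → Maybe Form₂
sub₂ n X xs G ⊥₂ = just ⊥₂
sub₂ n X xs G (pv m Y ts) with m ≟ n | Y ≟ X
... | yes refl | yes refl = sub₁ (zipσ xs ts) G
... | _ | _ = just (pv m Y ts)
sub₂ n X xs G (bin c A B) =
  sub₂ n X xs G A >>= λ A' → sub₂ n X xs G B >>= λ B' → just (bin c A' B')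
sub₂ n X xs G (qf q y A) =
  if not (memV (so n X) (FV A)) then just (qf q y A)
  else if memV (fo y) (FVabs xs G) then nothing
  else Maybe.map (qf q y) (sub₂ n X xs G A)
sub₂ n X xs G (qs q m Y A) =
  if eqV (so m Y) (so n X) || not (memV (so n X) (FV A)) then just (qs q m Y A)
  else if memV (so m Y) (FVabs xs G) then nothing
  else Maybe.map (qs q m Y) (sub₂ n X xs G A)

idxs : (n : ℕ) → Vec ℕ n
idxs n = tabulate toℕ

rename₂ : (n X Y : ℕ) → Form₂ → Maybe Form₂
rename₂ n X Y = sub₂ n X (idxs n) (pv n Y (Vec.map var (idxs n)))

infix 3 _⊢_

data _⊢_ : List Form₂ → Form₂ → Set where
  hyp  : ∀ {Γ A} → A ∈ Γ → Γ ⊢ A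
  ⊥E   : ∀ {Γ A} → Γ ⊢ ⊥₂ → Γ ⊢ A
  ⇒I   : ∀ {Γ A B} → (A ∷ Γ) ⊢ B → Γ ⊢ bin imp A B
  ⇒E   : ∀ {Γ A B} → Γ ⊢ bin imp A B → Γ ⊢ A → Γ ⊢ B
  ∧I   : ∀ {Γ A B} → Γ ⊢ A → Γ ⊢ B → Γ ⊢ bin and A B
  ∧E₁  : ∀ {Γ A B} → Γ ⊢ bin and A B → Γ ⊢ A
  ∧E₂  : ∀ {Γ A B} → Γ ⊢ bin and A B → Γ ⊢ B
  ∨I₁  : ∀ {Γ A B} → Γ ⊢ A → Γ ⊢ bin or A B
  ∨I₂  : ∀ {Γ A B} → Γ ⊢ B → Γ ⊢ bin or A B
  ∨E   : ∀ {Γ A B C} → Γ ⊢ bin or A B → (A ∷ Γ) ⊢ C → (B ∷ Γ) ⊢ C → Γ ⊢ C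
  ∀¹I  : ∀ {Γ x A A'} y → subst₁ x (var y) A ≡ just A' →
         memV (fo y) (FVctx (qf all x A ∷ Γ)) ≡ false → Γ ⊢ A' → Γ ⊢ qf all x A
  ∀¹E  : ∀ {Γ x A B} t → Γ ⊢ qf all x A → subst₁ x t A ≡ just B → Γ ⊢ B
  ∃¹I  : ∀ {Γ x A B} t → subst₁ x t A ≡ just B → Γ ⊢ B → Γ ⊢ qf ex x A
  ∃¹E  : ∀ {Γ x A A' C} y → Γ ⊢ qf ex x A → subst₁ x (var y) A ≡ just A' →
         memV (fo y) (FVctx (qf ex x A ∷ C ∷ Γ)) ≡ false → (A' ∷ Γ) ⊢ C → Γ ⊢ C
  ∀²I  : ∀ {Γ n X A A'} Y → rename₂ n X Y A ≡ just A' →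
         memV (so n Y) (FVctx (qs all n X A ∷ Γ)) ≡ false → Γ ⊢ A' → Γ ⊢ qs all n X A
  ∀²E  : ∀ {Γ n X A B} (xs : Vec ℕ n) G → Γ ⊢ qs all n X A → sub₂ n X xs G A ≡ just B → Γ ⊢ B
  ∃²I  : ∀ {Γ n X A B} (xs : Vec ℕ n) G → sub₂ n X xs G A ≡ just B → Γ ⊢ B → Γ ⊢ qs ex n X A
  ∃²E  : ∀ {Γ n X A A' C} Y → Γ ⊢ qs ex n X A → rename₂ n X Y A ≡ just A' →
         memV (so n Y) (FVctx (qs ex n X A ∷ C ∷ Γ)) ≡ false → (A' ∷ Γ) ⊢ C → Γ ⊢ C

-- The first-order language L₁ (only relation symbols Ap_n, arity n+1)

data Form₁ : Set where
  ⊥₁   : Form₁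
  ap   : (n : ℕ) → Term → Vec Term n → Form₁
  bin₁ : Conn → Form₁ → Form₁ → Form₁
  qf₁  : Quant → ℕ → Form₁ → Form₁

vars₁ : Form₁ → List ℕ
vars₁ ⊥₁ = []
vars₁ (ap n t ts) = tvars t ++ tvarsV ts
vars₁ (bin₁ c A B) = vars₁ A ++ vars₁ B
vars₁ (qf₁ q x A) = x ∷ vars₁ A

fresh₁ : Form₁ → ℕ
fresh₁ F = suc (maxℕ (vars₁ F))

-- The family of bijections φ_n : V_n → V is a parameter φ.

Bij : Set
Bij = ℕ → ℕ ↔ ℕ

-- Coding  F ↦ F*, computed with a renaming environment:
-- ρ₁ says which L₁ variable a first-order variable currently stands for,
-- ρ₂ n X which L₁ variable the second-order variable X^n stands for
-- (ρ₂ starts as φ).  (Q x A)* = Q y (A[x:=y])*  with y fresh for A*.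
upd₁ : (ℕ → ℕ) → ℕ → ℕ → (ℕ → ℕ)
upd₁ ρ x y z = if eqℕ z x then y else ρ z

upd₂ : (ℕ → ℕ → ℕ) → ℕ → ℕ → ℕ → (ℕ → ℕ → ℕ)
upd₂ ρ n X y m Z = if eqℕ m n && eqℕ Z X then y else ρ m Z

starρ : (ℕ → ℕ) → (ℕ → ℕ → ℕ) → Form₂ → Form₁
starρ ρ₁ ρ₂ ⊥₂ = ⊥₁
starρ ρ₁ ρ₂ (pv n X ts) = ap n (var (ρ₂ n X)) (tsubV (λ z → var (ρ₁ z)) ts)
starρ ρ₁ ρ₂ (bin c A B) = bin₁ c (starρ ρ₁ ρ₂ A) (starρ ρ₁ ρ₂ B)
starρ ρ₁ ρ₂ (qf q x A) =
  qf₁ q (fresh₁ (starρ ρ₁ ρ₂ A)) (starρ (upd₁ ρ₁ x (fresh₁ (starρ ρ₁ ρ₂ A))) ρ₂ A)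
starρ ρ₁ ρ₂ (qs q n X A) =
  qf₁ q (fresh₁ (starρ ρ₁ ρ₂ A)) (starρ ρ₁ (upd₂ ρ₂ n X (fresh₁ (starρ ρ₁ ρ₂ A))) A)

star : Bij → Form₂ → Form₁
star φ = starρ (λ x → x) (λ n X → Inverse.to (φ n) X)

soArities : List Var → List ℕ
soArities = concatMap (λ { (fo _) → [] ; (so n _) → n ∷ [] })

boundArities : Bij → ℕ → Form₂ → List ℕ
boundArities φ x B =
  filterᵇ (λ i → memV (so i (Inverse.from (φ i) x)) (FV B))
          (upTo (suc (maxℕ (soArities (FV B)))))

bar : Bij → Form₁ → Form₂
bar φ ⊥₁ = ⊥₂
bar φ (ap n (var x) ts) = pv n (Inverse.from (φ n) x) ts
bar φ (ap n (fun k f us) ts) = ⊥₂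
bar φ (bin₁ c A B) = bin c (bar φ A) (bar φ B)
bar φ (qf₁ q x A) =
  qf q x (foldr (λ i C → qs q i (Inverse.from (φ i) x) C) (bar φ A) (boundArities φ x (bar φ A)))

binder : Var → Form₂ → Form₂
binder (fo x) A = qf all x A
binder (so n X) A = qs all n X A

∀s : List Var → Form₂ → Form₂
∀s χs A = foldr binder A χs

∀fo : ∀ {k} → Vec ℕ k → Form₂ → Form₂
∀fo xs A = Vec.foldr _ (qf all) A xs

SC₂ : Form₂ → Set
SC₂ F =
  Σ (List Var) λ χs → Σ ℕ λ n → Σ ℕ λ X → Σ (Vec ℕ n) λ xs → Σ Form₂ λ G →
    (F ≡ ∀s χs (qs ex n X (∀fo xs (G ⇔ pv n X (Vec.map var xs)))))
  × ((v : Var) → v ∈ FV G → v ∈ (map fo (Vec.toList xs) ++ χs))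
  × (memV (so n X) (FV G) ≡ false)
  × Closed F

SC₁ : Bij → Form₁ → Set
SC₁ φ F = Σ Form₂ λ G → SC₂ G × (F ≡ star φ G)

-- Both sides of each equivalence are closed theorems of intuitionistic second-order
-- logic, and any two closed theorems are equivalent. A formula ∀χ⃗ ∃Xⁿ ∀x⃗ (G ↔ X(x⃗))
-- of SC₂ is proved by instantiating Xⁿ with the abstraction λx⃗. G. Coding it into L₁
-- and back gives a formula of the same shape up to renaming: every quantifier over a
-- variable z is followed by quantifiers over those φᵢ⁻¹(z) that are free below it,
-- Xⁿ becomes Yⁿ = φₙ⁻¹(y), the x⃗ become fresh names z⃗ and G becomes some H. That
-- formula is proved by instantiating Yⁿ with λz⃗. H; the instance is capture-free
-- because every name chosen by the coding is fresh for the variables free in H.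

module Submission where

open import Data.Bool using (Bool; true; false; not; T; T?; if_then_else_)
  renaming (_∧_ to _&&_; _∨_ to _||_)
open import Data.Bool.ListAction using (any)
open import Data.Bool.Properties using (∧-zeroʳ)
open import Data.Empty using (⊥; ⊥-elim)
open import Data.Fin using (Fin; toℕ) renaming (zero to fzero; suc to fsuc)
open import Data.Fin.Properties using (toℕ-injective; suc-injective; 0≢1+n)
open import Data.List using (List; []; _∷_; _++_; map; foldr)
open import Data.List.Membership.Propositional using (_∈_; _∉_)
open import Data.List.Membership.Propositional.Properties
  using (∈-++⁺ˡ; ∈-++⁺ʳ; ∈-++⁻; ∈-map⁺; ∈-map⁻; ∈-filter⁺; ∈-filter⁻; ∈-upTo⁺)
open import Data.List.Properties using (map-++; foldr-++)
open import Data.List.Relation.Unary.Any using (here; there)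
import Data.List.Relation.Unary.Any as Any
open import Data.Maybe using (just)
import Data.Maybe as Maybe
open import Data.Nat using (ℕ; zero; suc; _≟_; _≤_; s≤s)
open import Data.List.Membership.DecPropositional _≟_ using () renaming (_∈?_ to _∈ℕ?_)
open import Data.Nat.Properties using (m≤m⊔n; m≤n⊔m; ≤-trans; 1+n≰n)
open import Data.Product using (Σ; ∃; ∃₂; _×_; _,_; proj₁; proj₂)
open import Data.Sum using (_⊎_; inj₁; inj₂; [_,_]′)
open import Data.Vec using (Vec; []; _∷_; tabulate)
import Data.Vec as Vec
open import Data.Vec.Properties using (tabulate∘lookup; tabulate-cong; toList-map)
open import Function.Base using (_∘_)
open import Function.Bundles using (Inverse; Injection)
open import Function.Properties.Inverse using (↔-sym; ↔⇒↣)
open import Relation.Binary.Definitions using (DecidableEquality)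
open import Relation.Binary.PropositionalEquality
  using (_≡_; _≢_; refl; sym; trans; cong; cong₂; subst; module ≡-Reasoning)
open import Relation.Nullary
  using (Dec; yes; no; does; proof; _because_; ¬?; _×-dec_; _⊎-dec_; map′)
open import Relation.Nullary.Decidable using (dec-true; dec-false)
open import Relation.Nullary.Reflects using (Reflects; ofʸ; ofⁿ)

open import Defs

no-member⇒[] : ∀ {A : Set} {L : List A} → (∀ {v} → v ∉ L) → L ≡ []
no-member⇒[] {L = []} _ = refl
no-member⇒[] {L = v ∷ L} v∉ = ⊥-elim (v∉ (here refl))

∈-∃++-last : ∀ {A : Set} → DecidableEquality A → ∀ {x : A} {L} → x ∈ L →
  ∃₂ λ P Q → L ≡ P ++ x ∷ Q × x ∉ Q
∈-∃++-last _≟_ {x} {y ∷ L} x∈ with Any.any? (x ≟_) L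
... | yes x∈L with P , Q , refl , x∉Q ← ∈-∃++-last _≟_ x∈L = y ∷ P , Q , refl , x∉Q
... | no x∉L with x∈
...   | here refl = [] , L , refl , x∉L
...   | there x∈L = ⊥-elim (x∉L x∈L)

eqℕ-reflects : ∀ x y → Reflects (x ≡ y) (eqℕ x y)
eqℕ-reflects x y with x ≟ y
... | yes x≡y = ofʸ x≡y
... | no x≢y = ofⁿ x≢y

eqℕ? : ∀ x y → Dec (x ≡ y)
eqℕ? x y = eqℕ x y because eqℕ-reflects x y

eqℕ-refl : ∀ x → eqℕ x x ≡ true
eqℕ-refl x = dec-true (eqℕ? x x) refl

fo-injective : ∀ {x y} → fo x ≡ fo y → x ≡ y
fo-injective refl = refl

so-injective : ∀ {n m X Y} → so n X ≡ so m Y → n ≡ m × X ≡ Y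
so-injective refl = refl , refl

fo≢so : ∀ {x n X} → fo x ≢ so n X
fo≢so ()

infix 4 _≟ᵛ_ _∈ᵛ?_

-- The Booleans these deciders compute are, definitionally, the tests eqV and memV of Defs,
-- so dec-true and dec-false evaluate those tests.

_≟ᵛ_ : DecidableEquality Var
does (v ≟ᵛ w) = eqV v w
proof (fo x ≟ᵛ fo y) =
  proof (map′ (cong fo) fo-injective (eqℕ? x y))
proof (so n X ≟ᵛ so m Y) =
  proof (map′ (λ { (refl , refl) → refl }) so-injective
              (eqℕ? n m ×-dec eqℕ? X Y))
proof (fo _ ≟ᵛ so _ _) = ofⁿ λ ()
proof (so _ _ ≟ᵛ fo _) = ofⁿ λ ()

_∈ᵛ?_ : (v : Var) (L : List Var) → Dec (v ∈ L)
does (v ∈ᵛ? L) = memV v L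
proof (v ∈ᵛ? []) = ofⁿ λ ()
proof (v ∈ᵛ? w ∷ L) = proof (map′ Any.fromSum Any.toSum ((v ≟ᵛ w) ⊎-dec (v ∈ᵛ? L)))

eqV-reflects : ∀ v w → Reflects (v ≡ w) (eqV v w)
eqV-reflects v w = proof (v ≟ᵛ w)

eqV-refl : ∀ v → eqV v v ≡ true
eqV-refl v = dec-true (v ≟ᵛ v) refl

≢⇒eqV-false : ∀ {v w} → v ≢ w → eqV v w ≡ false
≢⇒eqV-false {v} {w} = dec-false (v ≟ᵛ w)

module _ {v : Var} {L : List Var} where
  ∈⇒memV : v ∈ L → memV v L ≡ true
  ∈⇒memV = dec-true (v ∈ᵛ? L)

  ∉⇒memV : v ∉ L → memV v L ≡ false
  ∉⇒memV = dec-false (v ∈ᵛ? L)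

  memV-false⇒∉ : memV v L ≡ false → v ∉ L
  memV-false⇒∉ eq v∈ with () ← trans (sym (∈⇒memV v∈)) eq

T-does⁻ : ∀ {A : Set} (a? : Dec A) → T (does a?) → A
T-does⁻ (yes a) _ = a

T-does⁺ : ∀ {A : Set} (a? : Dec A) → A → T (does a?)
T-does⁺ (yes _) _ = _
T-does⁺ (no ¬a) a = ⊥-elim (¬a a)

∈-remove⁻ : ∀ {v w} L → v ∈ remove w L → v ∈ L × v ≢ w
∈-remove⁻ {w = w} L v∈ with v∈L , t ← ∈-filter⁻ (T? ∘ λ u → not (eqV u w)) v∈ =
  v∈L , T-does⁻ (¬? (_ ≟ᵛ w)) t

∈-remove⁺ : ∀ {v w} L → v ∈ L → v ≢ w → v ∈ remove w L
∈-remove⁺ {v} {w} L v∈L v≢w = ∈-filter⁺ (T? ∘ λ u → not (eqV u w)) v∈L (T-does⁺ (¬? (v ≟ᵛ w)) v≢w)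

any-fo≡memV-map : ∀ v L → any (λ x → eqV v (fo x)) L ≡ memV v (map fo L)
any-fo≡memV-map v [] = refl
any-fo≡memV-map v (x ∷ L) = cong (eqV v (fo x) ||_) (any-fo≡memV-map v L)

∈-FVabs⁻ : ∀ {k v} (xs : Vec ℕ k) G → v ∈ FVabs xs G → v ∈ FV G × v ∉ map fo (Vec.toList xs)
∈-FVabs⁻ {v = v} xs G v∈
  with v∈G , t ← ∈-filter⁻ (T? ∘ λ u → not (any (λ x → eqV u (fo x)) (Vec.toList xs))) v∈ =
  v∈G , T-does⁻ (¬? (v ∈ᵛ? map fo (Vec.toList xs)))
                (subst (λ b → T (not b)) (any-fo≡memV-map v (Vec.toList xs)) t)

bound-∉FVabs : ∀ {k v} {zs : Vec ℕ k} H → v ∈ map fo (Vec.toList zs) → v ∉ FVabs zs H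
bound-∉FVabs {zs = zs} H v∈zs v∈ = proj₂ (∈-FVabs⁻ zs H v∈) v∈zs

fo∈map-fo : ∀ {x L} → fo x ∈ map fo L → x ∈ L
fo∈map-fo x∈ with _ , x∈L , refl ← ∈-map⁻ fo x∈ = x∈L

so∉map-fo : ∀ {n X} L → so n X ∉ map fo L
so∉map-fo L X∈ with _ , _ , () ← ∈-map⁻ fo X∈

mutual
  tsub-var : ∀ {σ} → (∀ z → σ z ≡ var z) → ∀ t → tsub σ t ≡ t
  tsub-var σ≗var (var x) = σ≗var x
  tsub-var σ≗var (fun k f ts) = cong (fun k f) (tsubV-var σ≗var ts)

  tsubV-var : ∀ {σ k} → (∀ z → σ z ≡ var z) → (ts : Vec Term k) → tsubV σ ts ≡ ts
  tsubV-var σ≗var [] = refl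
  tsubV-var σ≗var (t ∷ ts) = cong₂ _∷_ (tsub-var σ≗var t) (tsubV-var σ≗var ts)

tvarsV-map-var : ∀ {k} (xs : Vec ℕ k) → tvarsV (Vec.map var xs) ≡ Vec.toList xs
tvarsV-map-var [] = refl
tvarsV-map-var (x ∷ xs) = cong (x ∷_) (tvarsV-map-var xs)

mutual
  tvars-rename : ∀ ρ t → tvars (tsub (var ∘ ρ) t) ≡ map ρ (tvars t)
  tvars-rename ρ (var x) = refl
  tvars-rename ρ (fun k f ts) = tvarsV-rename ρ ts

  tvarsV-rename : ∀ {k} ρ (ts : Vec Term k) → tvarsV (tsubV (var ∘ ρ) ts) ≡ map ρ (tvarsV ts)
  tvarsV-rename ρ [] = refl
  tvarsV-rename ρ (t ∷ ts) rewrite tvars-rename ρ t | tvarsV-rename ρ ts =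
    sym (map-++ ρ (tvars t) (tvarsV ts))

tsubV-rename-map-var : ∀ {k} ρ (xs : Vec ℕ k) →
  tsubV (var ∘ ρ) (Vec.map var xs) ≡ Vec.map var (Vec.map ρ xs)
tsubV-rename-map-var ρ [] = refl
tsubV-rename-map-var ρ (x ∷ xs) = cong (var (ρ x) ∷_) (tsubV-rename-map-var ρ xs)

any-false : ∀ {A : Set} {p : A → Bool} → (∀ x → p x ≡ false) → ∀ L → any p L ≡ false
any-false p≗false [] = refl
any-false p≗false (x ∷ L) rewrite p≗false x = any-false p≗false L

upd-var : ∀ {σ} → (∀ z → σ z ≡ var z) → ∀ y z → upd σ y (var y) z ≡ var z
upd-var σ≗var y z with z ≟ y
... | yes refl = refl
... | no _ = σ≗var z

var-captures-nothing : ∀ y z → (not (eqℕ z y) && memℕ y (tvars (var z))) ≡ false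
var-captures-nothing y z with eqℕ y z | eqℕ-reflects y z
... | true | ofʸ refl rewrite eqℕ-refl y = refl
... | false | ofⁿ _ = ∧-zeroʳ (not (eqℕ z y))

sub₁-var : ∀ {σ} → (∀ z → σ z ≡ var z) → ∀ A → sub₁ σ A ≡ just A
sub₁-var σ≗var ⊥₂ = refl
sub₁-var σ≗var (pv n X ts) = cong (just ∘ pv n X) (tsubV-var σ≗var ts)
sub₁-var σ≗var (bin c A B) rewrite sub₁-var σ≗var A | sub₁-var σ≗var B = refl
sub₁-var {σ} σ≗var (qf q y A)
  rewrite any-false {p = λ z → not (eqℕ z y) && memℕ y (tvars (σ z))}
            (λ z → subst (λ t → (not (eqℕ z y) && memℕ y (tvars t)) ≡ false)
                         (sym (σ≗var z)) (var-captures-nothing y z))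
            (fvFO A)
        | sub₁-var (upd-var σ≗var y) A = refl
sub₁-var σ≗var (qs q n X A) rewrite sub₁-var σ≗var A = refl

subst₁-self : ∀ x A → subst₁ x (var x) A ≡ just A
subst₁-self x = sub₁-var (upd-var (λ _ → refl) x)

zipσ-var : ∀ {k} (xs : Vec ℕ k) z → zipσ xs (Vec.map var xs) z ≡ var z
zipσ-var [] z = refl
zipσ-var (x ∷ xs) z with z ≟ x
... | yes refl = refl
... | no _ = zipσ-var xs z

module _ (n X : ℕ) {xs : Vec ℕ n} {G : Form₂} where
  sub₂-pv-≡ : ∀ ts → sub₂ n X xs G (pv n X ts) ≡ sub₁ (zipσ xs ts) G
  sub₂-pv-≡ ts with n ≟ n | X ≟ X
  ... | yes refl | yes refl = refl
  ... | no n≢n | _ = ⊥-elim (n≢n refl)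
  ... | yes refl | no X≢X = ⊥-elim (X≢X refl)

  sub₂-pv-≢ : ∀ {m Y} ts → so m Y ≢ so n X → sub₂ n X xs G (pv m Y ts) ≡ just (pv m Y ts)
  sub₂-pv-≢ {m} {Y} ts ≢X with m ≟ n | Y ≟ X
  ... | yes refl | yes refl = ⊥-elim (≢X refl)
  ... | no _ | _ = refl
  ... | yes refl | no _ = refl

  sub₂-∉FV : ∀ A → so n X ∉ FV A → sub₂ n X xs G A ≡ just A
  sub₂-∉FV ⊥₂ X∉ = refl
  sub₂-∉FV (pv m Y ts) X∉ = sub₂-pv-≢ ts λ { refl → X∉ (here refl) }
  sub₂-∉FV (bin c A B) X∉
    rewrite sub₂-∉FV A (X∉ ∘ ∈-++⁺ˡ) | sub₂-∉FV B (X∉ ∘ ∈-++⁺ʳ (FV A)) = refl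
  sub₂-∉FV (qf q y A) X∉ rewrite ∉⇒memV (X∉ ∘ λ X∈ → ∈-remove⁺ (FV A) X∈ λ ()) = refl
  sub₂-∉FV (qs q m Y A) X∉ with eqV (so m Y) (so n X) | eqV-reflects (so m Y) (so n X)
  ... | true | _ = refl
  ... | false | ofⁿ Y≢X rewrite ∉⇒memV (X∉ ∘ λ X∈ → ∈-remove⁺ (FV A) X∈ (Y≢X ∘ sym)) = refl

tsubV-map-var-tabulate : ∀ {n} σ (f : Fin n → ℕ) →
  tsubV σ (Vec.map var (tabulate f)) ≡ tabulate (σ ∘ f)
tsubV-map-var-tabulate {zero} σ f = refl
tsubV-map-var-tabulate {suc n} σ f = cong (σ (f fzero) ∷_) (tsubV-map-var-tabulate σ (f ∘ fsuc))

zipσ-tabulate-lookup : ∀ {n} (f : Fin n → ℕ) → (∀ {i j} → f i ≡ f j → i ≡ j) → (ts : Vec Term n) →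
  ∀ i → zipσ (tabulate f) ts (f i) ≡ Vec.lookup ts i
zipσ-tabulate-lookup f f-inj (t ∷ ts) fzero rewrite eqℕ-refl (f fzero) = refl
zipσ-tabulate-lookup f f-inj (t ∷ ts) (fsuc i)
  rewrite dec-false (eqℕ? (f (fsuc i)) (f fzero)) (0≢1+n ∘ sym ∘ f-inj)
  = zipσ-tabulate-lookup (f ∘ fsuc) (suc-injective ∘ f-inj) ts i

zipσ-idxs : ∀ n ts → tsubV (zipσ (idxs n) ts) (Vec.map var (idxs n)) ≡ ts
zipσ-idxs n ts =
  trans (tsubV-map-var-tabulate _ toℕ)
        (trans (tabulate-cong (zipσ-tabulate-lookup toℕ toℕ-injective ts)) (tabulate∘lookup ts))

FVabs-pv-map-var : ∀ {n X v} (xs : Vec ℕ n) → v ∈ FVabs xs (pv n X (Vec.map var xs)) → v ≡ so n X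
FVabs-pv-map-var {n} {X} xs v∈ with ∈-FVabs⁻ xs (pv n X (Vec.map var xs)) v∈
... | here refl , _ = refl
... | there v∈xs , v∉xs = ⊥-elim (v∉xs (subst (λ L → _ ∈ map fo L) (tvarsV-map-var xs) v∈xs))

module _ (n X : ℕ) where
  private
    fo∉FVabs-idxs : ∀ y → memV (fo y) (FVabs (idxs n) (pv n X (Vec.map var (idxs n)))) ≡ false
    fo∉FVabs-idxs y = ∉⇒memV (fo≢so ∘ FVabs-pv-map-var (idxs n))

  rename₂-self : ∀ A → rename₂ n X X A ≡ just A
  rename₂-self ⊥₂ = refl
  rename₂-self (pv m Y ts) with so m Y ≟ᵛ so n X
  ... | yes refl = trans (sub₂-pv-≡ n X ts) (cong (just ∘ pv n X) (zipσ-idxs n ts))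
  ... | no Y≢X = sub₂-pv-≢ n X ts Y≢X
  rename₂-self (bin c A B) rewrite rename₂-self A | rename₂-self B = refl
  rename₂-self (qf q y A) with memV (so n X) (FV A)
  ... | false = refl
  ... | true rewrite fo∉FVabs-idxs y | rename₂-self A = refl
  rename₂-self (qs q m Y A) with eqV (so m Y) (so n X) | eqV-reflects (so m Y) (so n X)
  ... | true | _ = refl
  ... | false | ofⁿ Y≢X with memV (so n X) (FV A)
  ...   | false = refl
  ...   | true rewrite ∉⇒memV (Y≢X ∘ FVabs-pv-map-var (idxs n)) | rename₂-self A = refl

quantify : Quant → Var → Form₂ → Form₂
quantify q (fo x) = qf q x
quantify q (so n X) = qs q n X

prefixed : Quant → List Var → Form₂ → Form₂
prefixed q vs A = foldr (quantify q) A vs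

∀s≡prefixed : ∀ χs A → ∀s χs A ≡ prefixed all χs A
∀s≡prefixed [] A = refl
∀s≡prefixed (fo x ∷ χs) A = cong (qf all x) (∀s≡prefixed χs A)
∀s≡prefixed (so n X ∷ χs) A = cong (qs all n X) (∀s≡prefixed χs A)

∀fo≡prefixed : ∀ {k} (ys : Vec ℕ k) A → ∀fo ys A ≡ prefixed all (map fo (Vec.toList ys)) A
∀fo≡prefixed [] A = refl
∀fo≡prefixed (y ∷ ys) A = cong (qf all y) (∀fo≡prefixed ys A)

FV-quantify : ∀ q v A → FV (quantify q v A) ≡ remove v (FV A)
FV-quantify q (fo x) A = refl
FV-quantify q (so n X) A = refl

∈-FV-prefixed⁻ : ∀ {q v} vs A → v ∈ FV (prefixed q vs A) → v ∈ FV A × v ∉ vs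
∈-FV-prefixed⁻ [] A v∈ = v∈ , λ ()
∈-FV-prefixed⁻ {q} (w ∷ vs) A v∈
  with v∈B , v≢w ← ∈-remove⁻ (FV (prefixed q vs A)) (subst (_ ∈_) (FV-quantify q w (prefixed q vs A)) v∈)
  with v∈A , v∉vs ← ∈-FV-prefixed⁻ {q} vs A v∈B =
  v∈A , [ v≢w , v∉vs ]′ ∘ Any.toSum

∈-FV-prefixed⁺ : ∀ {q v} vs A → v ∈ FV A → v ∉ vs → v ∈ FV (prefixed q vs A)
∈-FV-prefixed⁺ [] A v∈A v∉vs = v∈A
∈-FV-prefixed⁺ {q} (w ∷ vs) A v∈A v∉vs =
  subst (_ ∈_) (sym (FV-quantify q w (prefixed q vs A)))
        (∈-remove⁺ _ (∈-FV-prefixed⁺ vs A v∈A (v∉vs ∘ there)) (v∉vs ∘ here))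

∈-FV-∀fo⁺ : ∀ {k v} (ys : Vec ℕ k) E → v ∈ FV E → v ∉ map fo (Vec.toList ys) → v ∈ FV (∀fo ys E)
∈-FV-∀fo⁺ ys E v∈E v∉ys =
  subst (λ F → _ ∈ FV F) (sym (∀fo≡prefixed ys E)) (∈-FV-prefixed⁺ {all} _ E v∈E v∉ys)

module _ {n X : ℕ} {xs : Vec ℕ n} {G : Form₂} {q : Quant} where
  sub₂-prefixed : ∀ vs {A A'} → so n X ∉ vs → (∀ {v} → v ∈ vs → v ∉ FVabs xs G) →
    so n X ∈ FV A → sub₂ n X xs G A ≡ just A' →
    sub₂ n X xs G (prefixed q vs A) ≡ just (prefixed q vs A')
  sub₂-prefixed [] X∉vs vs-uncaptured X∈A eq = eq
  sub₂-prefixed (fo y ∷ vs) {A} X∉vs vs-uncaptured X∈A eq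
    rewrite ∈⇒memV (∈-FV-prefixed⁺ {q} vs A X∈A (X∉vs ∘ there))
          | ∉⇒memV (vs-uncaptured (here refl)) =
    cong (Maybe.map (qf q y)) (sub₂-prefixed vs (X∉vs ∘ there) (vs-uncaptured ∘ there) X∈A eq)
  sub₂-prefixed (so m Y ∷ vs) {A} X∉vs vs-uncaptured X∈A eq
    rewrite ≢⇒eqV-false (X∉vs ∘ here ∘ sym)
          | ∈⇒memV (∈-FV-prefixed⁺ {q} vs A X∈A (X∉vs ∘ there))
          | ∉⇒memV (vs-uncaptured (here refl)) =
    cong (Maybe.map (qs q m Y)) (sub₂-prefixed vs (X∉vs ∘ there) (vs-uncaptured ∘ there) X∈A eq)

module _ {n X : ℕ} {zs : Vec ℕ n} {H : Form₂} where
  sub₂-⇔-pv : ∀ G → so n X ∉ FV G → so n X ∉ FV H →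
    sub₂ n X zs H (G ⇔ pv n X (Vec.map var zs)) ≡ just (G ⇔ H)
  sub₂-⇔-pv G X∉G X∉H
    rewrite sub₂-∉FV n X {zs} {H} G X∉G | sub₂-pv-≡ n X {zs} {H} (Vec.map var zs)
          | sub₁-var (zipσ-var zs) H = refl

ClosedCtx : List Form₂ → Set
ClosedCtx Γ = FVctx Γ ≡ []

module _ {Γ : List Form₂} where
  eigenvariable-fresh : ∀ {A q} v → ClosedCtx Γ → memV v (FVctx (quantify q v A ∷ Γ)) ≡ false
  eigenvariable-fresh {A} {q} v Γ-closed = ∉⇒memV λ v∈ → case (∈-++⁻ (FV (quantify q v A)) v∈)
    where
    case : v ∈ FV (quantify q v A) ⊎ v ∈ FVctx Γ → ⊥
    case (inj₁ v∈A) = proj₂ (∈-remove⁻ (FV A) (subst (v ∈_) (FV-quantify q v A) v∈A)) refl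
    case (inj₂ v∈Γ) with () ← subst (v ∈_) Γ-closed v∈Γ

  ∀-intro : ∀ {A} v → ClosedCtx Γ → Γ ⊢ A → Γ ⊢ quantify all v A
  ∀-intro {A} (fo x) Γ-closed ⊢A =
    ∀¹I x (subst₁-self x A) (eigenvariable-fresh {A} {all} (fo x) Γ-closed) ⊢A
  ∀-intro {A} (so n X) Γ-closed ⊢A =
    ∀²I X (rename₂-self n X A) (eigenvariable-fresh {A} {all} (so n X) Γ-closed) ⊢A

  ∃-intro-self : ∀ {A} v → Γ ⊢ A → Γ ⊢ quantify ex v A
  ∃-intro-self {A} (fo x) ⊢A = ∃¹I (var x) (subst₁-self x A) ⊢A
  ∃-intro-self {A} (so n X) ⊢A = ∃²I (idxs n) (pv n X (Vec.map var (idxs n))) (rename₂-self n X A) ⊢A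

  prefixed-∀-intro : ∀ {A} vs → ClosedCtx Γ → Γ ⊢ A → Γ ⊢ prefixed all vs A
  prefixed-∀-intro [] Γ-closed ⊢A = ⊢A
  prefixed-∀-intro (v ∷ vs) Γ-closed ⊢A = ∀-intro v Γ-closed (prefixed-∀-intro vs Γ-closed ⊢A)

  prefixed-∃-intro-self : ∀ {A} vs → Γ ⊢ A → Γ ⊢ prefixed ex vs A
  prefixed-∃-intro-self [] ⊢A = ⊢A
  prefixed-∃-intro-self (v ∷ vs) ⊢A = ∃-intro-self v (prefixed-∃-intro-self vs ⊢A)

  prefixed-∃-intro : ∀ {n X A A'} {xs : Vec ℕ n} {G} P Q →
    so n X ∉ Q → (∀ {v} → v ∈ Q → v ∉ FVabs xs G) → so n X ∈ FV A → sub₂ n X xs G A ≡ just A' → Γ ⊢ A' → Γ ⊢ prefixed ex (P ++ so n X ∷ Q) A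
  prefixed-∃-intro {n} {X} {A} {A'} {xs} {G} P Q X∉Q Q-uncaptured X∈A A-instance ⊢A' =
    subst (Γ ⊢_) (sym (foldr-++ (quantify ex) A P (so n X ∷ Q)))
      (prefixed-∃-intro-self P
        (∃²I xs G (sub₂-prefixed Q X∉Q Q-uncaptured X∈A A-instance) (prefixed-∃-intro-self Q ⊢A')))

  ⇔-refl : ∀ A → Γ ⊢ A ⇔ A
  ⇔-refl A = ∧I (⇒I (hyp (here refl))) (⇒I (hyp (here refl)))

singleton-closed : ∀ A → Closed A → ClosedCtx (A ∷ [])
singleton-closed A A-closed = cong (_++ []) A-closed

closed-theorems-⇔ : ∀ {A B} → Closed A → Closed B →
  (∀ {Γ} → ClosedCtx Γ → Γ ⊢ A) → (∀ {Γ} → ClosedCtx Γ → Γ ⊢ B) → [] ⊢ A ⇔ B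
closed-theorems-⇔ {A} {B} A-closed B-closed ⊢A ⊢B =
  ∧I (⇒I (⊢B (singleton-closed A A-closed))) (⇒I (⊢A (singleton-closed B B-closed)))

Comprehension : (n X : ℕ) → Vec ℕ n → Form₂ → Form₂
Comprehension n X xs G = qs ex n X (∀fo xs (G ⇔ pv n X (Vec.map var xs)))

comprehension-provable : ∀ {Γ n X} (xs : Vec ℕ n) G → ClosedCtx Γ → so n X ∉ FV G →
  Γ ⊢ Comprehension n X xs G
comprehension-provable {n = n} {X} xs G Γ-closed X∉G =
  ∃²I xs G instance-eq
      (subst (_ ⊢_) (sym (∀fo≡prefixed xs (G ⇔ G)))
             (prefixed-∀-intro (map fo (Vec.toList xs)) Γ-closed (⇔-refl G)))
  where
  instance-eq : sub₂ n X xs G (∀fo xs (G ⇔ pv n X (Vec.map var xs))) ≡ just (∀fo xs (G ⇔ G))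
  instance-eq rewrite ∀fo≡prefixed xs (G ⇔ pv n X (Vec.map var xs)) | ∀fo≡prefixed xs (G ⇔ G) =
    sub₂-prefixed (map fo (Vec.toList xs)) (so∉map-fo (Vec.toList xs)) (bound-∉FVabs G)
      (∈-++⁺ˡ (∈-++⁺ʳ (FV G) (here refl))) (sub₂-⇔-pv G X∉G X∉G)

SC₂-closed : ∀ {F} → SC₂ F → Closed F
SC₂-closed (_ , _ , _ , _ , _ , _ , _ , _ , F-closed) = F-closed

SC₂-provable : ∀ {Γ F} → SC₂ F → ClosedCtx Γ → Γ ⊢ F
SC₂-provable (χs , n , X , xs , G , refl , _ , X∉G , _) Γ-closed =
  subst (_ ⊢_) (sym (∀s≡prefixed χs _))
        (prefixed-∀-intro χs Γ-closed (comprehension-provable xs G Γ-closed (memV-false⇒∉ X∉G)))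

∈⇒≤maxℕ : ∀ {k} L → k ∈ L → k ≤ maxℕ L
∈⇒≤maxℕ (x ∷ L) (here refl) = m≤m⊔n x (maxℕ L)
∈⇒≤maxℕ (x ∷ L) (there k∈L) = ≤-trans (∈⇒≤maxℕ L k∈L) (m≤n⊔m x (maxℕ L))

so∈⇒≤maxℕ-soArities : ∀ {i W} L → so i W ∈ L → i ≤ maxℕ (soArities L)
so∈⇒≤maxℕ-soArities (so n X ∷ L) (here refl) = m≤m⊔n n (maxℕ (soArities L))
so∈⇒≤maxℕ-soArities (fo x ∷ L) (there W∈L) = so∈⇒≤maxℕ-soArities L W∈L
so∈⇒≤maxℕ-soArities (so n X ∷ L) (there W∈L) =
  ≤-trans (so∈⇒≤maxℕ-soArities L W∈L) (m≤n⊔m n (maxℕ (soArities L)))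

fresh₁-∉ : ∀ {k} F → k ∈ vars₁ F → fresh₁ F ≢ k
fresh₁-∉ F k∈F refl = 1+n≰n (∈⇒≤maxℕ (vars₁ F) k∈F)

upd₁-≢ : ∀ ρ {x z w} → w ≢ x → upd₁ ρ x z w ≡ ρ w
upd₁-≢ ρ {x} {z} {w} w≢x =
  cong (λ b → if b then z else ρ w) (dec-false (eqℕ? w x) w≢x)

upd₂-≢ : ∀ ρ {m Y z i W} → so i W ≢ so m Y → upd₂ ρ m Y z i W ≡ ρ i W
upd₂-≢ ρ {z = z} {i} {W} W≢Y = cong (λ b → if b then z else ρ i W) (≢⇒eqV-false W≢Y)

upd₂-≡ : ∀ ρ m Y z → upd₂ ρ m Y z m Y ≡ z
upd₂-≡ ρ m Y z = cong (λ b → if b then z else ρ m Y) (eqV-refl (so m Y))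

vars₁-starρ-fo : ∀ ρ₁ ρ₂ A {w} → fo w ∈ FV A → ρ₁ w ∈ vars₁ (starρ ρ₁ ρ₂ A)
vars₁-starρ-fo ρ₁ ρ₂ (pv n X ts) (there w∈) with u , u∈ , refl ← ∈-map⁻ fo w∈ =
  there (subst (_ ∈_) (sym (tvarsV-rename ρ₁ ts)) (∈-map⁺ ρ₁ u∈))
vars₁-starρ-fo ρ₁ ρ₂ (bin c A B) w∈ with ∈-++⁻ (FV A) w∈
... | inj₁ w∈A = ∈-++⁺ˡ (vars₁-starρ-fo ρ₁ ρ₂ A w∈A)
... | inj₂ w∈B = ∈-++⁺ʳ (vars₁ (starρ ρ₁ ρ₂ A)) (vars₁-starρ-fo ρ₁ ρ₂ B w∈B)
vars₁-starρ-fo ρ₁ ρ₂ (qf q x A) w∈ with w∈A , w≢x ← ∈-remove⁻ (FV A) w∈ =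
  there (subst (_∈ vars₁ (starρ ρ₁' ρ₂ A)) (upd₁-≢ ρ₁ (w≢x ∘ cong fo)) (vars₁-starρ-fo ρ₁' ρ₂ A w∈A))
  where ρ₁' = upd₁ ρ₁ x (fresh₁ (starρ ρ₁ ρ₂ A))
vars₁-starρ-fo ρ₁ ρ₂ (qs q n X A) w∈ = there (vars₁-starρ-fo ρ₁ _ A (proj₁ (∈-remove⁻ (FV A) w∈)))

vars₁-starρ-so : ∀ ρ₁ ρ₂ A {i W} → so i W ∈ FV A → ρ₂ i W ∈ vars₁ (starρ ρ₁ ρ₂ A)
vars₁-starρ-so ρ₁ ρ₂ (pv n X ts) (here refl) = here refl
vars₁-starρ-so ρ₁ ρ₂ (pv n X ts) (there W∈) with _ , _ , () ← ∈-map⁻ fo W∈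
vars₁-starρ-so ρ₁ ρ₂ (bin c A B) W∈ with ∈-++⁻ (FV A) W∈
... | inj₁ W∈A = ∈-++⁺ˡ (vars₁-starρ-so ρ₁ ρ₂ A W∈A)
... | inj₂ W∈B = ∈-++⁺ʳ (vars₁ (starρ ρ₁ ρ₂ A)) (vars₁-starρ-so ρ₁ ρ₂ B W∈B)
vars₁-starρ-so ρ₁ ρ₂ (qf q x A) W∈ = there (vars₁-starρ-so _ ρ₂ A (proj₁ (∈-remove⁻ (FV A) W∈)))
vars₁-starρ-so ρ₁ ρ₂ (qs q m Y A) W∈ with W∈A , W≢Y ← ∈-remove⁻ (FV A) W∈ =
  there (subst (_∈ vars₁ (starρ ρ₁ ρ₂' A)) (upd₂-≢ ρ₂ W≢Y) (vars₁-starρ-so ρ₁ ρ₂' A W∈A))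
  where ρ₂' = upd₂ ρ₂ m Y (fresh₁ (starρ ρ₁ ρ₂ A))

module Coding (φ : Bij) where
  open ≡-Reasoning

  φ⁻¹ : ℕ → ℕ → ℕ
  φ⁻¹ i = Inverse.from (φ i)

  φ⁻¹-injective : ∀ i {a b} → φ⁻¹ i a ≡ φ⁻¹ i b → a ≡ b
  φ⁻¹-injective i = Injection.injective (↔⇒↣ (↔-sym (φ i)))

  soBinders : ℕ → Form₂ → List Var
  soBinders z C = map (λ i → so i (φ⁻¹ i z)) (boundArities φ z C)

  bar-qf₁ : ∀ q z B → bar φ (qf₁ q z B) ≡ qf q z (prefixed q (soBinders z (bar φ B)) (bar φ B))
  bar-qf₁ q z B = cong (qf q z) (chain≡prefixed (boundArities φ z (bar φ B)))
    where
    chain≡prefixed : ∀ bs → foldr (λ i C → qs q i (φ⁻¹ i z) C) (bar φ B) bs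
                            ≡ prefixed q (map (λ i → so i (φ⁻¹ i z)) bs) (bar φ B)
    chain≡prefixed [] = refl
    chain≡prefixed (b ∷ bs) = cong (qs q b (φ⁻¹ b z)) (chain≡prefixed bs)

  ∈-soBinders : ∀ {z i} C → so i (φ⁻¹ i z) ∈ FV C → so i (φ⁻¹ i z) ∈ soBinders z C
  ∈-soBinders {z} {i} C i∈C =
    ∈-map⁺ (λ i → so i (φ⁻¹ i z))
      (∈-filter⁺ (T? ∘ λ j → memV (so j (φ⁻¹ j z)) (FV C))
                 (∈-upTo⁺ (s≤s (so∈⇒≤maxℕ-soArities (FV C) i∈C)))
                 (T-does⁺ (so i (φ⁻¹ i z) ∈ᵛ? FV C) i∈C))

  ∈-FV-bar-qf₁⁻ : ∀ {q z B v} → v ∈ FV (bar φ (qf₁ q z B)) →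
    v ∈ FV (bar φ B) × v ≢ fo z × v ∉ soBinders z (bar φ B)
  ∈-FV-bar-qf₁⁻ {q} {z} {B} {v} v∈
    with v∈P , v≢z ← ∈-remove⁻ (FV (prefixed q (soBinders z (bar φ B)) (bar φ B)))
                                (subst (λ C → v ∈ FV C) (bar-qf₁ q z B) v∈)
    with v∈B , v∉binders ← ∈-FV-prefixed⁻ {q} (soBinders z (bar φ B)) (bar φ B) v∈P =
    v∈B , v≢z , v∉binders

  FreeImage : (ℕ → ℕ) → (ℕ → ℕ → ℕ) → List Var → Var → Set
  FreeImage ρ₁ ρ₂ L v =
    (∃ λ x → fo x ∈ L × v ≡ fo (ρ₁ x)) ⊎ (∃₂ λ i W → so i W ∈ L × v ≡ so i (φ⁻¹ i (ρ₂ i W)))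

  FreeImage-mono : ∀ {ρ₁ ρ₂ L L' v} → (∀ {u} → u ∈ L → u ∈ L') →
    FreeImage ρ₁ ρ₂ L v → FreeImage ρ₁ ρ₂ L' v
  FreeImage-mono L⊆L' (inj₁ (x , x∈ , refl)) = inj₁ (x , L⊆L' x∈ , refl)
  FreeImage-mono L⊆L' (inj₂ (i , W , W∈ , refl)) = inj₂ (i , W , L⊆L' W∈ , refl)

  so-bound-by-bar-qf₁ : ∀ q z B i → so i (φ⁻¹ i z) ∉ FV (bar φ (qf₁ q z B))
  so-bound-by-bar-qf₁ q z B i Z∈ with Z∈B , _ , Z∉binders ← ∈-FV-bar-qf₁⁻ {q} {z} {B} Z∈ =
    Z∉binders (∈-soBinders (bar φ B) Z∈B)

  FV-bar-starρ : ∀ ρ₁ ρ₂ A {v} → v ∈ FV (bar φ (starρ ρ₁ ρ₂ A)) → FreeImage ρ₁ ρ₂ (FV A) v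
  FV-bar-starρ ρ₁ ρ₂ (pv n X ts) (here refl) = inj₂ (n , X , here refl , refl)
  FV-bar-starρ ρ₁ ρ₂ (pv n X ts) (there v∈)
    with w , w∈ , refl ← ∈-map⁻ fo v∈
    with x , x∈ , refl ← ∈-map⁻ ρ₁ (subst (w ∈_) (tvarsV-rename ρ₁ ts) w∈) =
    inj₁ (x , there (∈-map⁺ fo x∈) , refl)
  FV-bar-starρ ρ₁ ρ₂ (bin c A B) v∈ with ∈-++⁻ (FV (bar φ (starρ ρ₁ ρ₂ A))) v∈
  ... | inj₁ v∈A = FreeImage-mono ∈-++⁺ˡ (FV-bar-starρ ρ₁ ρ₂ A v∈A)
  ... | inj₂ v∈B = FreeImage-mono (∈-++⁺ʳ (FV A)) (FV-bar-starρ ρ₁ ρ₂ B v∈B)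
  FV-bar-starρ ρ₁ ρ₂ (qf q x A) v∈
    with v∈B , v≢z , _ ← ∈-FV-bar-qf₁⁻ {q} {fresh₁ (starρ ρ₁ ρ₂ A)}
                                        {starρ (upd₁ ρ₁ x (fresh₁ (starρ ρ₁ ρ₂ A))) ρ₂ A} v∈
    with FV-bar-starρ (upd₁ ρ₁ x (fresh₁ (starρ ρ₁ ρ₂ A))) ρ₂ A v∈B
  ... | inj₂ (i , W , W∈ , refl) = inj₂ (i , W , ∈-remove⁺ (FV A) W∈ (λ ()) , refl)
  ... | inj₁ (w , w∈ , refl) with w ≟ x
  ...   | yes refl = ⊥-elim (v≢z refl)
  ...   | no w≢x = inj₁ (w , ∈-remove⁺ (FV A) w∈ (w≢x ∘ fo-injective) , refl)
  FV-bar-starρ ρ₁ ρ₂ (qs q m Y A) v∈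
    with v∈B , _ ← ∈-FV-bar-qf₁⁻ {q} {fresh₁ (starρ ρ₁ ρ₂ A)}
                                  {starρ ρ₁ (upd₂ ρ₂ m Y (fresh₁ (starρ ρ₁ ρ₂ A))) A} v∈
    with FV-bar-starρ ρ₁ (upd₂ ρ₂ m Y (fresh₁ (starρ ρ₁ ρ₂ A))) A v∈B
  ... | inj₁ (w , w∈ , refl) = inj₁ (w , ∈-remove⁺ (FV A) w∈ (λ ()) , refl)
  ... | inj₂ (i , W , W∈ , refl) with so i W ≟ᵛ so m Y
  ...   | yes refl = ⊥-elim (so-bound-by-bar-qf₁ q z B m (subst (λ u → so m (φ⁻¹ m u) ∈ FV (bar φ (qf₁ q z B)))
                                                             (upd₂-≡ ρ₂ m Y z) v∈))
    where
    z = fresh₁ (starρ ρ₁ ρ₂ A)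
    B = starρ ρ₁ (upd₂ ρ₂ m Y z) A
  ...   | no W≢Y = inj₂ (i , W , ∈-remove⁺ (FV A) W∈ W≢Y , cong (so i ∘ φ⁻¹ i) (upd₂-≢ ρ₂ W≢Y))

  module ∀fo-Unfolding (R : ℕ → ℕ → ℕ) (E : Form₂) where
    Avoids : (ℕ → ℕ) → ∀ {k} → Vec ℕ k → ℕ → Set
    Avoids ρ ys z = (∀ {w} → fo w ∈ FV (∀fo ys E) → ρ w ≢ z) × (∀ {i W} → so i W ∈ FV E → R i W ≢ z)

    BindsFresh : (ℕ → ℕ) → ∀ {k} → Vec ℕ k → Var → Set
    BindsFresh ρ ys v = ∃ λ z → Avoids ρ ys z × (v ≡ fo z ⊎ ∃ λ i → v ≡ so i (φ⁻¹ i z))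

    record Unfolding (ρ : ℕ → ℕ) {k} (ys : Vec ℕ k) : Set where
      field
        env : ℕ → ℕ
        binders : List Var
        unfolds : bar φ (starρ ρ R (∀fo ys E)) ≡ prefixed all binders (bar φ (starρ env R E))
        env-outside : ∀ {w} → w ∉ Vec.toList ys → env w ≡ ρ w
        binders-fresh : ∀ {v} → v ∈ binders → BindsFresh ρ ys v

    fresh-avoids : ∀ ρ {k} (ys : Vec ℕ k) → Avoids ρ ys (fresh₁ (starρ ρ R (∀fo ys E)))
    fresh-avoids ρ ys =
      (λ w∈ → fresh₁-∉ (starρ ρ R (∀fo ys E)) (vars₁-starρ-fo ρ R (∀fo ys E) w∈) ∘ sym) ,
      (λ W∈ → fresh₁-∉ (starρ ρ R (∀fo ys E))
                       (vars₁-starρ-so ρ R (∀fo ys E) (∈-FV-∀fo⁺ ys E W∈ (so∉map-fo _))) ∘ sym)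

    Avoids-∷ : ∀ {ρ ρ' x k z} (ys : Vec ℕ k) → (∀ {w} → w ≢ x → ρ' w ≡ ρ w) →
               Avoids ρ' ys z → Avoids ρ (x ∷ ys) z
    Avoids-∷ {ρ} {ρ'} {x} {z = z} ys agree (fo-avoids , so-avoids) = fo-avoids' , so-avoids
      where
      fo-avoids' : ∀ {w} → fo w ∈ FV (∀fo (x ∷ ys) E) → ρ w ≢ z
      fo-avoids' w∈ with w∈' , w≢x ← ∈-remove⁻ (FV (∀fo ys E)) w∈ =
        subst (_≢ z) (agree (w≢x ∘ cong fo)) (fo-avoids w∈')

    fresh-avoids-∷ : ∀ ρ x {k} (ys : Vec ℕ k) → Avoids ρ (x ∷ ys) (fresh₁ (starρ ρ R (∀fo ys E)))
    fresh-avoids-∷ ρ x ys = Avoids-∷ {ρ} {ρ} {x} ys (λ _ → refl) (fresh-avoids ρ ys)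

    unfold : ∀ ρ {k} (ys : Vec ℕ k) → Unfolding ρ ys
    unfold ρ [] = record
      { env = ρ ; binders = [] ; unfolds = refl ; env-outside = λ _ → refl ; binders-fresh = λ () }
    unfold ρ (x ∷ ys) = record
      { env = env
      ; binders = fo z ∷ soBinders z B ++ binders
      ; unfolds = unfolds′
      ; env-outside = λ w∉ → trans (env-outside (w∉ ∘ there)) (upd₁-≢ ρ (w∉ ∘ here))
      ; binders-fresh = binders-fresh′
      }
      where
      z = fresh₁ (starρ ρ R (∀fo ys E))
      ρ' = upd₁ ρ x z
      B = bar φ (starρ ρ' R (∀fo ys E))
      open Unfolding (unfold ρ' ys)

      unfolds′ : bar φ (starρ ρ R (∀fo (x ∷ ys) E))
                 ≡ prefixed all (fo z ∷ soBinders z B ++ binders) (bar φ (starρ env R E))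
      unfolds′ = begin
        bar φ (qf₁ all z (starρ ρ' R (∀fo ys E)))        ≡⟨ bar-qf₁ all z (starρ ρ' R (∀fo ys E)) ⟩
        qf all z (prefixed all (soBinders z B) B)
          ≡⟨ cong (qf all z ∘ prefixed all (soBinders z B)) unfolds ⟩
        qf all z (prefixed all (soBinders z B) (prefixed all binders (bar φ (starρ env R E))))
          ≡⟨ cong (qf all z) (sym (foldr-++ (quantify all) _ (soBinders z B) binders)) ⟩
        qf all z (prefixed all (soBinders z B ++ binders) (bar φ (starρ env R E))) ∎

      binders-fresh′ : ∀ {v} → v ∈ fo z ∷ soBinders z B ++ binders → BindsFresh ρ (x ∷ ys) v
      binders-fresh′ (here refl) = z , fresh-avoids-∷ ρ x ys , inj₁ refl
      binders-fresh′ (there v∈) with ∈-++⁻ (soBinders z B) v∈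
      ... | inj₁ v∈so with i , _ , refl ← ∈-map⁻ (λ i → so i (φ⁻¹ i z)) v∈so =
        z , fresh-avoids-∷ ρ x ys , inj₂ (i , refl)
      ... | inj₂ v∈binders with z' , avoids , v≡ ← binders-fresh v∈binders =
        z' , Avoids-∷ {ρ} {ρ'} ys (upd₁-≢ ρ) avoids , v≡

  -- bar (starρ ρ₁ ρ₂ (∃Xⁿ ∀x⃗ (G ⇔ X x⃗))) is ∃y, then ∃-quantifiers over some φᵢ⁻¹(y),
  -- then D = ∀binders (H ⇔ Y z⃗) with Y = φₙ⁻¹(y).
  module CodedComprehension (ρ₁ : ℕ → ℕ) (ρ₂ : ℕ → ℕ → ℕ) {n X : ℕ} (xs : Vec ℕ n) (G : Form₂)
                             (X∉G : so n X ∉ FV G) where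
    E : Form₂
    E = G ⇔ pv n X (Vec.map var xs)

    y : ℕ
    y = fresh₁ (starρ ρ₁ ρ₂ (∀fo xs E))

    R : ℕ → ℕ → ℕ
    R = upd₂ ρ₂ n X y

    open ∀fo-Unfolding R E using (module Unfolding; unfold)
    open Unfolding (unfold ρ₁ xs)

    zs : Vec ℕ n
    zs = Vec.map env xs

    H D : Form₂
    H = bar φ (starρ env R G)
    D = bar φ (starρ ρ₁ R (∀fo xs E))

    X∈E : so n X ∈ FV E
    X∈E = ∈-++⁺ˡ (∈-++⁺ʳ (FV G) (here refl))

    -- y codes only X; the other second-order variables of G keep their ρ₂-names, which y avoids.
    R≢y : ∀ {i W} → so i W ∈ FV G → R i W ≢ y
    R≢y {i} {W} W∈G R≡y = fresh₁-∉ (starρ ρ₁ ρ₂ (∀fo xs E)) ρ₂W∈ (sym (trans (sym (upd₂-≢ ρ₂ W≢X)) R≡y))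
      where
      W≢X : so i W ≢ so n X
      W≢X refl = X∉G W∈G
      ρ₂W∈ : ρ₂ i W ∈ vars₁ (starρ ρ₁ ρ₂ (∀fo xs E))
      ρ₂W∈ = vars₁-starρ-so ρ₁ ρ₂ (∀fo xs E) (∈-FV-∀fo⁺ xs E (∈-++⁺ˡ (∈-++⁺ˡ W∈G)) (so∉map-fo _))

    y-∉FV-H : ∀ i → so i (φ⁻¹ i y) ∉ FV H
    y-∉FV-H i Y∈H with FV-bar-starρ env R G Y∈H
    ... | inj₁ (_ , _ , ())
    ... | inj₂ (_ , W , W∈G , Y≡) with refl , y≡ ← so-injective Y≡ = R≢y W∈G (sym (φ⁻¹-injective i y≡))

    body-unfolds : bar φ (starρ env R E) ≡ H ⇔ pv n (φ⁻¹ n y) (Vec.map var zs)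
    body-unfolds = cong₂ (λ u ts → H ⇔ pv n (φ⁻¹ n u) ts) (upd₂-≡ ρ₂ n X y) (tsubV-rename-map-var env xs)

    Y∉binders : so n (φ⁻¹ n y) ∉ binders
    Y∉binders Y∈ with z , (_ , so-avoids) , inj₂ (_ , Y≡) ← binders-fresh Y∈
                 with refl , y≡ ← so-injective Y≡ =
      so-avoids X∈E (trans (upd₂-≡ ρ₂ n X y) (φ⁻¹-injective n y≡))

    binder-uncaptured : ∀ {v} → v ∈ binders → v ∉ FVabs zs H
    binder-uncaptured v∈ v∈abs with ∈-FVabs⁻ zs H v∈abs | binders-fresh v∈
    ... | v∈H , v∉zs | z , (fo-avoids , so-avoids) , inj₁ refl with FV-bar-starρ env R G v∈H
    ...   | inj₂ (_ , _ , _ , ())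
    ...   | inj₁ (x , x∈G , refl) with x ∈ℕ? Vec.toList xs
    ...     | yes x∈xs = v∉zs (∈-map⁺ fo (subst (env x ∈_) (sym (toList-map env xs)) (∈-map⁺ env x∈xs)))
    ...     | no x∉xs =
      fo-avoids (∈-FV-∀fo⁺ xs E (∈-++⁺ˡ (∈-++⁺ˡ x∈G)) (x∉xs ∘ fo∈map-fo)) (sym (env-outside x∉xs))
    binder-uncaptured v∈ v∈abs | v∈H , _ | z , (_ , so-avoids) , inj₂ (i , refl)
      with FV-bar-starρ env R G v∈H
    ... | inj₁ (_ , _ , ())
    ... | inj₂ (_ , W , W∈G , Z≡) with refl , z≡ ← so-injective Z≡ =
      so-avoids (∈-++⁺ˡ (∈-++⁺ˡ W∈G)) (sym (φ⁻¹-injective i z≡))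

    y-binder-uncaptured : ∀ {v} → v ∈ soBinders y D → v ∉ FVabs zs H
    y-binder-uncaptured v∈ v∈abs with i , _ , refl ← ∈-map⁻ (λ i → so i (φ⁻¹ i y)) v∈ =
      y-∉FV-H i (proj₁ (∈-FVabs⁻ zs H v∈abs))

    D-unfolds : D ≡ prefixed all binders (H ⇔ pv n (φ⁻¹ n y) (Vec.map var zs))
    D-unfolds = trans unfolds (cong (prefixed all binders) body-unfolds)

    Y∈body : so n (φ⁻¹ n y) ∈ FV (H ⇔ pv n (φ⁻¹ n y) (Vec.map var zs))
    Y∈body = ∈-++⁺ˡ (∈-++⁺ʳ (FV H) (here refl))

    Y∈D : so n (φ⁻¹ n y) ∈ FV D
    Y∈D = subst (λ F → so n (φ⁻¹ n y) ∈ FV F) (sym D-unfolds)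
                (∈-FV-prefixed⁺ {all} binders (H ⇔ pv n (φ⁻¹ n y) (Vec.map var zs)) Y∈body Y∉binders)

    D-instance : sub₂ n (φ⁻¹ n y) zs H D ≡ just (prefixed all binders (H ⇔ H))
    D-instance rewrite D-unfolds =
      sub₂-prefixed binders Y∉binders binder-uncaptured Y∈body (sub₂-⇔-pv H (y-∉FV-H n) (y-∉FV-H n))

    -- The last quantifier over Y = φₙ⁻¹(y) following ∃y is the one that binds Y in D.
    provable : ∀ {Γ} → ClosedCtx Γ → Γ ⊢ bar φ (starρ ρ₁ ρ₂ (Comprehension n X xs G))
    provable {Γ} Γ-closed with P , Q , split , Y∉Q ← ∈-∃++-last _≟ᵛ_ (∈-soBinders D Y∈D) =
      subst (Γ ⊢_) (sym (bar-qf₁ ex y (starρ ρ₁ R (∀fo xs E))))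
        (∃-intro-self (fo y) (subst (λ Ps → Γ ⊢ prefixed ex Ps D) (sym split)
          (prefixed-∃-intro P Q Y∉Q
             (λ v∈Q → y-binder-uncaptured (subst (_ ∈_) (sym split) (∈-++⁺ʳ P (there v∈Q))))
             Y∈D D-instance (prefixed-∀-intro binders Γ-closed (⇔-refl H)))))

  bar-qf₁-∀-intro : ∀ {Γ z B} → ClosedCtx Γ → Γ ⊢ bar φ B → Γ ⊢ bar φ (qf₁ all z B)
  bar-qf₁-∀-intro {Γ} {z} {B} Γ-closed ⊢B =
    subst (Γ ⊢_) (sym (bar-qf₁ all z B))
          (∀-intro (fo z) Γ-closed (prefixed-∀-intro (soBinders z (bar φ B)) Γ-closed ⊢B))

  bar-starρ-∀s-intro : ∀ {Γ A} → ClosedCtx Γ → (∀ ρ₁ ρ₂ → Γ ⊢ bar φ (starρ ρ₁ ρ₂ A)) →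
    ∀ χs ρ₁ ρ₂ → Γ ⊢ bar φ (starρ ρ₁ ρ₂ (∀s χs A))
  bar-starρ-∀s-intro Γ-closed ⊢A [] ρ₁ ρ₂ = ⊢A ρ₁ ρ₂
  bar-starρ-∀s-intro Γ-closed ⊢A (fo x ∷ χs) ρ₁ ρ₂ =
    bar-qf₁-∀-intro Γ-closed (bar-starρ-∀s-intro Γ-closed ⊢A χs _ ρ₂)
  bar-starρ-∀s-intro Γ-closed ⊢A (so m Z ∷ χs) ρ₁ ρ₂ =
    bar-qf₁-∀-intro Γ-closed (bar-starρ-∀s-intro Γ-closed ⊢A χs ρ₁ _)

  bar-star-SC₂-provable : ∀ {Γ F} → SC₂ F → ClosedCtx Γ → Γ ⊢ bar φ (star φ F)
  bar-star-SC₂-provable (χs , n , X , xs , G , refl , _ , X∉G , _) Γ-closed =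
    bar-starρ-∀s-intro Γ-closed
      (λ ρ₁ ρ₂ → CodedComprehension.provable ρ₁ ρ₂ xs G (memV-false⇒∉ X∉G) Γ-closed)
      χs _ _

  bar-star-closed : ∀ F → Closed F → Closed (bar φ (star φ F))
  bar-star-closed F F-closed = no-member⇒[] λ v∈ → no-free-image (FV-bar-starρ _ _ F v∈)
    where
    no-free-image : ∀ {v} → FreeImage (λ x → x) (λ n X → Inverse.to (φ n) X) (FV F) v → ⊥
    no-free-image (inj₁ (_ , x∈ , _)) with () ← subst (_ ∈_) F-closed x∈
    no-free-image (inj₂ (_ , _ , W∈ , _)) with () ← subst (_ ∈_) F-closed W∈

module _ (φ : Bij) {F : Form₂} (F∈SC₂ : SC₂ F) where
  open Coding φ using (bar-star-closed; bar-star-SC₂-provable)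

  bar-star-⇔ : [] ⊢ bar φ (star φ F) ⇔ F
  bar-star-⇔ = closed-theorems-⇔ (bar-star-closed F (SC₂-closed F∈SC₂)) (SC₂-closed F∈SC₂)
                                   (bar-star-SC₂-provable F∈SC₂) (SC₂-provable F∈SC₂)

  ⇔-bar-star : [] ⊢ F ⇔ bar φ (star φ F)
  ⇔-bar-star = closed-theorems-⇔ (SC₂-closed F∈SC₂) (bar-star-closed F (SC₂-closed F∈SC₂))
                                   (SC₂-provable F∈SC₂) (bar-star-SC₂-provable F∈SC₂)

corollary1 : (φ : Bij) →
    ((F : Form₁) → SC₁ φ F → Σ Form₂ (λ G → SC₂ G × ([] ⊢ bar φ F ⇔ G)))
    × ((G : Form₂) → SC₂ G → Σ Form₁ (λ F → SC₁ φ F × ([] ⊢ G ⇔ bar φ F)))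
corollary1 φ =
  (λ { F (G , G∈SC₂ , refl) → G , G∈SC₂ , bar-star-⇔ φ G∈SC₂ }) ,
  (λ G G∈SC₂ → star φ G , (G , G∈SC₂ , refl) , ⇔-bar-star φ G∈SC₂)
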